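{- Let $2\le k<g$ be integers. If, in $Y(g,k)$, an even pivot node $[s,s]$ with $s\ne0$ directly precedes or directly succeeds the node $[0,0]$, then $Y(g,k)$ is a complete Young graph.
   Context: For integers $2\le k<g$, the labeled directed graph $H(g,k)$ has a distinguished starting node $[[0,0]]$ and other nodes labeled by pairs $[R,r]$ of integers with $0\le R,r\le k-1$ (the node $[0,0]$ is distinct from the starting node). For a node $[P,p]$ (the starting node treated as $[0,0]$ here) there is an edge labeled $(A,a)$ from $[P,p]$ to $[R,r]$ whenever $0\le A,a\le g-1$ are integers, $0\le R,r\le k-1$, $ka+p=A+rg$ and $kA+R=a+Pg$; edges leaving the starting node additionally require $A\ne0\ne a$; no edge enters the starting node. $H(g,k)$ consists of the starting node and all nodes reachable from it. An even pivot node is a node $[a,a]$; an odd pivot node is a node $[r,s]$ with an edge to $[s,r]$; the starting node is not a pivot node. $Y(g,k)$ is obtained from $H(g,k)$ by deleting every node that is not a pivot node and from which no pivot node is reachable, with incident edges. $Y(g,k)$ is a complete Young graph (on $m$ nodes) if its nodes other than the starting node are $m$ nodes forming the complete directed graph on them (an edge from each to each, including self-loops) and there is an edge from the starting node to every node except $[0,0]$. -}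

module Defs where

open import Data.Nat using (ℕ; _+_; _*_; _<_)
open import Data.Product using (Σ; _×_; ∃)
open import Data.Sum using (_⊎_)
open import Data.Unit using (⊤)
open import Data.Empty using (⊥)
open import Relation.Nullary using (¬_)
open import Relation.Binary.PropositionalEquality using (_≡_; _≢_)
open import Relation.Binary.Construct.Closure.ReflexiveTransitive using (Star)

-- Nodes of H(g,k): the distinguished starting node [[0,0]], and nodes [R,r].
data Node : Set where
  start : Node
  node  : ℕ → ℕ → Node

fstC : Node → ℕ
fstC start      = 0
fstC (node P p) = P

sndC : Node → ℕ
sndC start      = 0
sndC (node P p) = p

StartOK : Node → ℕ → ℕ → Set
StartOK start      A a = (A ≢ 0) × (a ≢ 0)
StartOK (node _ _) A a = ⊤

Edge : ℕ → ℕ → Node → Node → Set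
Edge g k u start      = ⊥
Edge g k u (node R r) =
  (R < k) × (r < k) ×
  Σ ℕ λ A → Σ ℕ λ a →
    (A < g) × (a < g) × StartOK u A a ×
    (k * a + sndC u ≡ A + r * g) × (k * A + R ≡ a + fstC u * g)

InH : ℕ → ℕ → Node → Set
InH g k v = Star (Edge g k) start v

EvenPivot : Node → Set
EvenPivot start      = ⊥
EvenPivot (node R r) = R ≡ r

OddPivot : ℕ → ℕ → Node → Set
OddPivot g k start      = ⊥
OddPivot g k (node r s) = Edge g k (node r s) (node s r)

Pivot : ℕ → ℕ → Node → Set
Pivot g k v = EvenPivot v ⊎ OddPivot g k v

InY : ℕ → ℕ → Node → Set
InY g k v = InH g k v × (Pivot g k v ⊎ ∃ λ w → Pivot g k w × Star (Edge g k) v w)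

-- Edges of Y(g,k): edges of H(g,k) between nodes of Y(g,k) (the endpoint
-- membership is stated separately where used).

IsCompleteYoung : ℕ → ℕ → Set
IsCompleteYoung g k =
  InY g k start ×
  (∀ R r S s → InY g k (node R r) → InY g k (node S s) →
      Edge g k (node R r) (node S s)) ×
  (∀ R r → InY g k (node R r) → ¬ (node R r ≡ node 0 0) →
      Edge g k start (node R r))

module Submission where

open import Defs
open import Data.Nat using (ℕ; _≤_; _<_)
open import Data.Product using (_×_)
open import Data.Sum using (_⊎_)
open import Relation.Binary.PropositionalEquality using (_≢_)

open import Data.Nat using (zero; suc; _+_; _*_; _%_; z≤n; s≤s; s≤s⁻¹; NonZero; ≢-nonZero)
open import Data.Nat.Properties
open import Data.Nat.DivMod using ([m+kn]%n≡m%n; m<n⇒m%n≡m)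
open import Data.Nat.Divisibility using (_∣_; divides; ∣m∣n⇒∣m+n; ∣m+n∣m⇒∣n; ∣n⇒∣m*n; m∣m*n)
open import Data.Nat.Tactic.RingSolver using (solve; solve-∀)
open import Data.List using (_∷_; [])
open import Data.Product using (_,_; proj₁)
open import Data.Sum using (inj₁; inj₂)
open import Data.Unit using (⊤; tt)
open import Data.Empty using (⊥-elim)
open import Relation.Binary.PropositionalEquality
  using (_≡_; refl; sym; trans; cong; cong₂; subst; module ≡-Reasoning)
open import Relation.Binary.Construct.Closure.ReflexiveTransitive using (Star; ε; _◅_)

-- Write g = k + c and M = k² − 1.  Eliminating A from the two label equations
-- of an edge [P,P] → [R,r] with label (A,a) gives
--     R + M·a = r + (P·c + M·r + k·r·c).                          (∗)
-- Call a node balanced if it is [R,R] with R < k and M ∣ R·c (the starting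
-- node counting as [0,0]).  The hypothesis edge yields M ∣ s·c.  Multiplying
-- (∗) by s shows s·R ≡ s·r (mod M) for an edge out of a balanced node; both
-- sides are below M, so R = r, and then (∗) gives M ∣ k·R·c, hence M ∣ R·c
-- because k² = M + 1 makes k invertible modulo M.  Thus every node of H(g,k)
-- is balanced.  Conversely, for balanced P, R with P·c = e·M, R·c = f·M the
-- label A = f + P + k·e, a = e + R + k·f always yields an edge [P,P] → [R,R]
-- (and one from the starting node when R ≠ 0), so Y(g,k) is complete.

preserved-along : ∀ {I : Set} {E : I → I → Set} (Q : I → Set) →
  (∀ {u v} → E u v → Q u → Q v) → ∀ {u v} → Star E u v → Q u → Q v
preserved-along Q step ε        q = q
preserved-along Q step (e ◅ es) q = preserved-along Q step es (step e q)

cancel-multiples : ∀ {m x y z} u → x < m → y < m → m ∣ z → x + u * m ≡ y + z → x ≡ y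
cancel-multiples {m@(suc _)} {x} {y} u x<m y<m (divides v refl) eq = begin
  x                ≡⟨ m<n⇒m%n≡m x<m ⟨
  x % m            ≡⟨ [m+kn]%n≡m%n x u m ⟨
  (x + u * m) % m  ≡⟨ cong (_% m) eq ⟩
  (y + v * m) % m  ≡⟨ [m+kn]%n≡m%n y v m ⟩
  y % m            ≡⟨ m<n⇒m%n≡m y<m ⟩
  y                ∎
  where open ≡-Reasoning

-- Every non-starting node of H(g,k) has both coordinates below k, because
-- every edge enters such a node.
InRange : ℕ → Node → Set
InRange k start      = ⊤
InRange k (node R r) = R < k × r < k

reachable-in-range : ∀ {g k v} → InH g k v → InRange k v
reachable-in-range p = preserved-along (InRange _) edge-in-range p tt
  where
  edge-in-range : ∀ {g k u v} → Edge g k u v → InRange k u → InRange k v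
  edge-in-range {v = node R r} (R<k , r<k , _) _ = R<k , r<k

square-pred : ∀ t → (2 + t) * (2 + t) ≡ suc ((1 + t) * (3 + t))
square-pred = solve-∀

module Diagonal (k M c : ℕ) {{_ : NonZero M}} (k²≡1+M : k * k ≡ suc M) where

  g : ℕ
  g = k + c

  -- k ≠ 0 since k² ≠ 0; needed because the starting node counts as [0,0].
  0<k : 0 < k
  0<k = n≢0⇒n>0 λ k≡0 → 0≢1+n (trans (cong (λ x → x * x) (sym k≡0)) k²≡1+M)

  k*k*x≡M*x+x : ∀ x → k * (k * x) ≡ M * x + x
  k*k*x≡M*x+x x = begin
    k * (k * x)  ≡⟨ *-assoc k k x ⟨
    k * k * x    ≡⟨ cong (_* x) k²≡1+M ⟩
    x + M * x    ≡⟨ +-comm x (M * x) ⟩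
    M * x + x    ∎
    where open ≡-Reasoning

  ∣k*⇒∣ : ∀ x → M ∣ k * x → M ∣ x
  ∣k*⇒∣ x d = ∣m+n∣m⇒∣n (subst (M ∣_) (k*k*x≡M*x+x x) (∣n⇒∣m*n k d)) (m∣m*n x)

  range-bound : ∀ {P R} → P < k → R < k → P + k * R ≤ M
  range-bound {P} {R} P<k R<k = s≤s⁻¹ (begin
    suc P + k * R  ≤⟨ +-monoˡ-≤ (k * R) P<k ⟩
    k + k * R      ≡⟨ *-suc k R ⟨
    k * suc R      ≤⟨ *-monoʳ-≤ k R<k ⟩
    k * k          ≡⟨ k²≡1+M ⟩
    suc M          ∎)
    where open ≤-Reasoning

  product-bound : ∀ {s R} → s ≢ 0 → s < k → R < k → s * R < M
  product-bound {zero}      s≢0 _   _   = ⊥-elim (s≢0 refl)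
  product-bound {suc s} {R} _   s<k R<k =
    ≤-trans (s≤s (≤-trans (*-monoˡ-≤ R (<⇒≤ s<k)) (m≤n+m (k * R) s)))
            (range-bound s<k R<k)

  -- The right-hand side of (∗) beyond the target coordinate r.
  excess : ℕ → ℕ → ℕ
  excess P r = P * c + M * r + k * r * c

  edge-equation : ∀ {P R r A a} → k * a + P ≡ A + r * g → k * A + R ≡ a + P * g →
                  R + M * a ≡ r + excess P r
  edge-equation {P} {R} {r} {A} {a} e₁ e₂ = +-cancelˡ-≡ (a + k * P) _ _ (begin
    (a + k * P) + (R + M * a)              ≡⟨ solve (k ∷ M ∷ a ∷ P ∷ R ∷ []) ⟩
    (M * a + a) + k * P + R                ≡⟨ cong (λ x → x + k * P + R) (k*k*x≡M*x+x a) ⟨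
    k * (k * a) + k * P + R                ≡⟨ solve (k ∷ a ∷ P ∷ R ∷ []) ⟩
    k * (k * a + P) + R                    ≡⟨ cong (λ x → k * x + R) e₁ ⟩
    k * (A + r * (k + c)) + R              ≡⟨ solve (k ∷ A ∷ r ∷ c ∷ R ∷ []) ⟩
    (k * A + R) + k * (r * (k + c))        ≡⟨ cong (_+ k * (r * g)) e₂ ⟩
    a + P * (k + c) + k * (r * (k + c))    ≡⟨ solve (k ∷ c ∷ a ∷ P ∷ r ∷ []) ⟩
    (a + k * P) + (P * c + k * (k * r) + k * r * c)
      ≡⟨ cong (λ x → (a + k * P) + (P * c + x + k * r * c)) (k*k*x≡M*x+x r) ⟩
    (a + k * P) + (P * c + (M * r + r) + k * r * c)
      ≡⟨ solve (k ∷ M ∷ c ∷ a ∷ P ∷ r ∷ []) ⟩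
    (a + k * P) + (r + (P * c + M * r + k * r * c))  ∎)
    where open ≡-Reasoning

  ∣s*excess : ∀ {s P} r → M ∣ s * c → M ∣ P * c → M ∣ s * excess P r
  ∣s*excess {s} {P} r s∣ P∣ = subst (M ∣_) regroup
    (∣m∣n⇒∣m+n (∣m∣n⇒∣m+n (∣n⇒∣m*n s P∣) (∣n⇒∣m*n s (m∣m*n r))) (∣n⇒∣m*n (k * r) s∣))
    where
    regroup : s * (P * c) + s * (M * r) + k * r * (s * c) ≡ s * (P * c + M * r + k * r * c)
    regroup = solve (k ∷ M ∷ c ∷ s ∷ P ∷ r ∷ [])

  -- An edge out of a balanced node ends on the diagonal: s·R ≡ s·r (mod M)
  -- with both sides below M.
  lands-on-diagonal : ∀ {s P R r a} → s ≢ 0 → s < k → M ∣ s * c → M ∣ P * c →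
    R < k → r < k → R + M * a ≡ r + excess P r → R ≡ r
  lands-on-diagonal {s} {P} {R} {r} {a} s≢0 s<k s∣ P∣ R<k r<k eq =
    *-cancelˡ-≡ R r s {{≢-nonZero s≢0}}
      (cancel-multiples (s * a) (product-bound s≢0 s<k R<k) (product-bound s≢0 s<k r<k)
        (∣s*excess {s} {P} r s∣ P∣) scaled)
    where
    scaled : s * R + s * a * M ≡ s * r + s * excess P r
    scaled = begin
      s * R + s * a * M        ≡⟨ solve (M ∷ s ∷ R ∷ a ∷ []) ⟩
      s * (R + M * a)          ≡⟨ cong (s *_) eq ⟩
      s * (r + excess P r)     ≡⟨ *-distribˡ-+ s r (excess P r) ⟩
      s * r + s * excess P r   ∎
      where open ≡-Reasoning

  -- On the diagonal, (∗) says M·a = P·c + M·R + k·R·c, so M ∣ k·R·c and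
  -- therefore M ∣ R·c.
  diagonal-divisible : ∀ {P R a} → M ∣ P * c → R + M * a ≡ R + excess P R → M ∣ R * c
  diagonal-divisible {P} {R} {a} P∣ eq =
    ∣k*⇒∣ (R * c) (subst (M ∣_) (*-assoc k R c) kRc-divisible)
    where
    kRc-divisible : M ∣ k * R * c
    kRc-divisible = ∣m+n∣m⇒∣n
      (divides a (trans (sym (+-cancelˡ-≡ R _ _ eq)) (*-comm M a)))
      (∣m∣n⇒∣m+n P∣ (m∣m*n R))

  Balanced : Node → Set
  Balanced u = sndC u ≡ fstC u × fstC u < k × M ∣ fstC u * c

  balanced-step : ∀ {s} → s ≢ 0 → s < k → M ∣ s * c →
                  ∀ {u v} → Edge g k u v → Balanced u → Balanced v
  balanced-step {s} s≢0 s<k s∣ {u} {node R r}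
                (R<k , r<k , A , a , _ , _ , _ , e₁ , e₂) (p≡P , _ , P∣) =
    sym R≡r , R<k ,
    diagonal-divisible {fstC u} {R} {a} P∣
      (subst (λ x → R + M * a ≡ x + excess (fstC u) x) (sym R≡r) eq)
    where
    eq : R + M * a ≡ r + excess (fstC u) r
    eq = edge-equation {fstC u} {R} {r} {A} {a} (subst (λ p → k * a + p ≡ A + r * g) p≡P e₁) e₂
    R≡r : R ≡ r
    R≡r = lands-on-diagonal {s} {fstC u} {R} {r} {a} s≢0 s<k s∣ P∣ R<k r<k eq

  reachable-balanced : ∀ {s} → s ≢ 0 → s < k → M ∣ s * c → ∀ {v} → InH g k v → Balanced v
  reachable-balanced s≢0 s<k s∣ p =
    preserved-along Balanced (balanced-step s≢0 s<k s∣) p (refl , 0<k , divides 0 refl)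

  quotient-bound : ∀ {P R e f} → P < k → R < k → P * c ≡ e * M → R * c ≡ f * M → e + k * f ≤ c
  quotient-bound {P} {R} {e} {f} P<k R<k hP hR = *-cancelʳ-≤ (e + k * f) c M (begin
    (e + k * f) * M      ≡⟨ solve (k ∷ M ∷ e ∷ f ∷ []) ⟩
    e * M + k * (f * M)  ≡⟨ cong₂ (λ x y → x + k * y) hP hR ⟨
    P * c + k * (R * c)  ≡⟨ solve (k ∷ c ∷ P ∷ R ∷ []) ⟩
    (P + k * R) * c      ≤⟨ *-monoˡ-≤ c (range-bound P<k R<k) ⟩
    M * c                ≡⟨ *-comm M c ⟩
    c * M                ∎)
    where open ≤-Reasoning

  label-bound : ∀ {P R e f} → P < k → R < k → P * c ≡ e * M → R * c ≡ f * M → e + R + k * f < g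
  label-bound {P} {R} {e} {f} P<k R<k hP hR =
    subst (_< g) regroup (+-mono-<-≤ R<k (quotient-bound P<k R<k hP hR))
    where
    regroup : R + (e + k * f) ≡ e + R + k * f
    regroup = solve (k ∷ e ∷ R ∷ f ∷ [])

  -- The label (f + P + k·e, e + R + k·f) satisfies the first edge equation
  -- from [P,P] to [R,R] (the second is the same with the roles swapped).
  label-equation : ∀ {P R e f} → R * c ≡ f * M →
                   k * (e + R + k * f) + P ≡ (f + P + k * e) + R * g
  label-equation {P} {R} {e} {f} hR = begin
    k * (e + R + k * f) + P              ≡⟨ solve (k ∷ e ∷ R ∷ f ∷ P ∷ []) ⟩
    k * (k * f) + (k * e + k * R + P)    ≡⟨ cong (_+ (k * e + k * R + P)) (k*k*x≡M*x+x f) ⟩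
    M * f + f + (k * e + k * R + P)
      ≡⟨ cong (λ x → x + f + (k * e + k * R + P)) (trans (*-comm M f) (sym hR)) ⟩
    R * c + f + (k * e + k * R + P)      ≡⟨ solve (k ∷ c ∷ e ∷ R ∷ f ∷ P ∷ []) ⟩
    (f + P + k * e) + R * (k + c)        ∎
    where open ≡-Reasoning

  diagonal-edge : ∀ u {R e f} → sndC u ≡ fstC u → fstC u < k → R < k →
    fstC u * c ≡ e * M → R * c ≡ f * M →
    StartOK u (f + fstC u + k * e) (e + R + k * f) → Edge g k u (node R R)
  diagonal-edge u {R} {e} {f} p≡P P<k R<k hP hR ok =
    R<k , R<k , _ , _ ,
    label-bound {R} {P} {f} {e} R<k P<k hR hP , label-bound {P} {R} {e} {f} P<k R<k hP hR , ok ,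
    trans (cong (λ p → k * (e + R + k * f) + p) p≡P) (label-equation {P} {R} {e} {f} hR) ,
    label-equation {R} {P} {f} {e} hP
    where
    P : ℕ
    P = fstC u

  quotient-nonzero : ∀ {R f} → c ≢ 0 → R ≢ 0 → R * c ≡ f * M → f ≢ 0
  quotient-nonzero {R} c≢0 R≢0 hR refl with m*n≡0⇒m≡0∨n≡0 R hR
  ... | inj₁ R≡0 = R≢0 R≡0
  ... | inj₂ c≡0 = c≢0 c≡0

  complete-young : ∀ {s} → c ≢ 0 → s ≢ 0 → s < k → M ∣ s * c →
                   InY g k (node 0 0) → IsCompleteYoung g k
  complete-young c≢0 s≢0 s<k s∣ Y00 =
    (ε , inj₂ (node 0 0 , inj₁ refl , proj₁ Y00)) , between , from-start
    where
    balanced : ∀ {v} → InY g k v → Balanced v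
    balanced y = reachable-balanced s≢0 s<k s∣ (proj₁ y)

    between : ∀ R r S s′ → InY g k (node R r) → InY g k (node S s′) →
              Edge g k (node R r) (node S s′)
    between R r S s′ yR yS with balanced yR | balanced yS
    ... | refl , R<k , divides e hR | refl , S<k , divides f hS =
      diagonal-edge (node R R) {S} {e} {f} refl R<k S<k hR hS tt

    from-start : ∀ R r → InY g k (node R r) → node R r ≢ node 0 0 → Edge g k start (node R r)
    from-start R r y R≢00 with balanced y
    ... | refl , R<k , divides f hR =
      diagonal-edge start {R} {0} {f} refl 0<k R<k refl hR (A≢0 , a≢0)
      where
      R≢0 : R ≢ 0
      R≢0 refl = R≢00 refl
      A≢0 : f + 0 + k * 0 ≢ 0
      A≢0 h = quotient-nonzero c≢0 R≢0 hR (m+n≡0⇒m≡0 f (m+n≡0⇒m≡0 (f + 0) h))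
      a≢0 : R + k * f ≢ 0
      a≢0 h = R≢0 (m+n≡0⇒m≡0 R h)

  pivot-divisible : ∀ {s} → Edge g k (node s s) (node 0 0) ⊎ Edge g k (node 0 0) (node s s) →
                    M ∣ s * c
  pivot-divisible {s} (inj₁ (_ , _ , A , a , _ , _ , _ , e₁ , e₂)) =
    divides a (begin
      s * c                      ≡⟨ solve (k ∷ M ∷ c ∷ s ∷ []) ⟩
      s * c + M * 0 + k * 0 * c  ≡⟨ edge-equation {s} {0} {0} {A} {a} e₁ e₂ ⟨
      M * a                      ≡⟨ *-comm M a ⟩
      a * M                      ∎)
    where open ≡-Reasoning
  pivot-divisible {s} (inj₂ (_ , _ , A , a , _ , _ , _ , e₁ , e₂)) =
    diagonal-divisible {0} {s} {a} (divides 0 refl) (edge-equation {0} {s} {s} {A} {a} e₁ e₂)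

corollary6 : (g k : ℕ) → 2 ≤ k → k < g →
    (s : ℕ) → s ≢ 0 →
    InY g k (node s s) → InY g k (node 0 0) →
    (Edge g k (node s s) (node 0 0) ⊎ Edge g k (node 0 0) (node s s)) →
    IsCompleteYoung g k
corollary6 g k@(suc (suc t)) (s≤s (s≤s z≤n)) k<g s s≢0 Ys Y00 adjacent
  with o , k+1+o≡g ← m≤n⇒∃[o]m+o≡n k<g
  with refl ← trans (+-suc k o) k+1+o≡g =
  complete-young (λ ()) s≢0 s<k (pivot-divisible adjacent) Y00
  where
  open Diagonal k ((1 + t) * (3 + t)) (suc o) (square-pred t)
  s<k : s < k
  s<k = proj₁ (reachable-in-range (proj₁ Ys))
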